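{- Let $k,n$ be positive integers with $n\ge 6$, $k\le n/2$, and $$\frac{2^n}{n+1}<\binom nk\le \frac{2^n}n.$$ Then $k=f(n)$, where $f(n)$ is the least positive integer $r$ such that $\binom nr>\frac{2^n}{n+1}$.
   Context: For an integer $n\ge 3$, $f(n)$ denotes the least positive integer $r$ such that $\binom nr>\frac{2^n}{n+1}$. -}

module Defs where

open import Data.Nat using (ℕ; _+_; _*_; _^_; _<_; _≤_)
open import Data.Nat.Combinatorics using (_C_)
open import Data.Product using (_×_)
open import Data.Empty using (⊥)

-- "C(n,r) > 2^n/(n+1)", cleared of the positive denominator n+1
BigBinom : ℕ → ℕ → Set
BigBinom n r = 2 ^ n < (n + 1) * (n C r)

IsLeastF : ℕ → ℕ → Set
IsLeastF n r = (1 ≤ r) × BigBinom n r × (∀ s → 1 ≤ s → s < r → BigBinom n s → ⊥)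

-- Absorption, (k+1)·C(n,k+1) + k·C(n,k) = n·C(n,k), shows that C(n,·) increases up to n/2 and
-- that (n+1)·C(n,k-1) ≤ n·C(n,k) whenever 2k ≤ n. So for every s < k,
-- (n+1)·C(n,s) ≤ (n+1)·C(n,k-1) ≤ n·C(n,k) ≤ 2^n, i.e. C(n,s) ≤ 2^n/(n+1), and k is the least r
-- with C(n,r) > 2^n/(n+1).
module Submission where

open import Defs
open import Data.Nat using (ℕ; zero; suc; _+_; _*_; _^_; _<_; _≤_; z≤n; s≤s; _≤′_; ≤′-refl; ≤′-step)
open import Data.Nat.Combinatorics using (_C_; nCk+nC[k+1]≡[n+1]C[k+1]; nC1≡n; k>n⇒nCk≡0)
open import Data.Nat.Properties
open import Data.Nat.Solver using (module +-*-Solver)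
open import Data.Product using (_,_)
open import Data.Empty using (⊥)
open import Relation.Binary.PropositionalEquality
open +-*-Solver

[k+1]*nC[k+1]+k*nCk≡n*nCk : ∀ n k → suc k * (n C suc k) + k * (n C k) ≡ n * (n C k)
[k+1]*nC[k+1]+k*nCk≡n*nCk zero zero = refl
[k+1]*nC[k+1]+k*nCk≡n*nCk zero (suc k)
  rewrite k>n⇒nCk≡0 {0} {suc k} (s≤s z≤n) | k>n⇒nCk≡0 {0} {suc (suc k)} (s≤s z≤n) | *-zeroʳ k = refl
[k+1]*nC[k+1]+k*nCk≡n*nCk (suc n) zero
  rewrite nC1≡n (suc n) = trans (+-identityʳ _) (trans (*-identityˡ _) (sym (*-identityʳ _)))
[k+1]*nC[k+1]+k*nCk≡n*nCk (suc n) (suc k) = begin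
  suc (suc k) * (suc n C suc (suc k)) + suc k * (suc n C suc k)
    ≡⟨ cong₂ (λ u v → suc (suc k) * u + suc k * v)
             (sym (nCk+nC[k+1]≡[n+1]C[k+1] n (suc k))) (sym (nCk+nC[k+1]≡[n+1]C[k+1] n k)) ⟩
  suc (suc k) * (b + c) + suc k * (a + b)
    ≡⟨ solve 4 (λ K A B C → (con 2 :+ K) :* (B :+ C) :+ (con 1 :+ K) :* (A :+ B)
                 := ((con 2 :+ K) :* C :+ (con 1 :+ K) :* B) :+ ((con 1 :+ K) :* B :+ K :* A) :+ A :+ B)
             refl k a b c ⟩
  (suc (suc k) * c + suc k * b) + (suc k * b + k * a) + a + b
    ≡⟨ cong₂ (λ u v → u + v + a + b) ([k+1]*nC[k+1]+k*nCk≡n*nCk n (suc k)) ([k+1]*nC[k+1]+k*nCk≡n*nCk n k) ⟩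
  n * b + n * a + a + b
    ≡⟨ solve 3 (λ N A B → N :* B :+ N :* A :+ A :+ B := (con 1 :+ N) :* (A :+ B)) refl n a b ⟩
  suc n * (a + b)
    ≡⟨ cong (suc n *_) (nCk+nC[k+1]≡[n+1]C[k+1] n k) ⟩
  suc n * (suc n C suc k)
    ∎
  where
  open ≡-Reasoning
  a = n C k
  b = n C suc k
  c = n C suc (suc k)

nCk≤nC[k+1] : ∀ {n k} → 2 * k < n → n C k ≤ n C suc k
nCk≤nC[k+1] {n} {k} 2k<n = *-cancelˡ-≤ (suc k) (+-cancelʳ-≤ (k * a) _ _ (begin
  suc k * a + k * a   ≡⟨ solve 2 (λ K A → (con 1 :+ K) :* A :+ K :* A := (con 1 :+ con 2 :* K) :* A) refl k a ⟩
  suc (2 * k) * a     ≤⟨ *-monoˡ-≤ a 2k<n ⟩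
  n * a               ≡⟨ [k+1]*nC[k+1]+k*nCk≡n*nCk n k ⟨
  suc k * b + k * a   ∎))
  where
  open ≤-Reasoning
  a = n C k
  b = n C suc k

2*k<2*[1+k] : ∀ k → 2 * k < 2 * suc k
2*k<2*[1+k] k = *-monoʳ-< 2 (n<1+n k)

nCi≤nCj : ∀ {n i j} → i ≤′ j → 2 * j ≤ n → n C i ≤ n C j
nCi≤nCj ≤′-refl 2j≤n = ≤-refl
nCi≤nCj {n} (≤′-step {j} i≤′j) 2j≤n =
  ≤-trans (nCi≤nCj i≤′j (<⇒≤ 2j<n)) (nCk≤nC[k+1] 2j<n)
  where
  2j<n : 2 * j < n
  2j<n = <-≤-trans (2*k<2*[1+k] j) 2j≤n

-- Writing n = 2(k+1) + d, the difference n·n - ((k+1)(n+1) + n·k) is the polynomial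
-- (k+1) + 2kd + 3d + d² with nonnegative coefficients.
[k+1]*[n+1]+n*k≤n*n : ∀ {n k} → 2 * suc k ≤ n → suc k * (n + 1) + n * k ≤ n * n
[k+1]*[n+1]+n*k≤n*n {k = k} 2[k+1]≤n with m≤n⇒∃[o]m+o≡n 2[k+1]≤n
... | d , refl = ≤-trans (m≤m+n _ (k + 1 + 2 * k * d + 3 * d + d * d)) (≤-reflexive
  (solve 2 (λ K D → (con 1 :+ K) :* (con 2 :* (con 1 :+ K) :+ D :+ con 1) :+ (con 2 :* (con 1 :+ K) :+ D) :* K
                      :+ (K :+ con 1 :+ con 2 :* K :* D :+ con 3 :* D :+ D :* D)
                    := (con 2 :* (con 1 :+ K) :+ D) :* (con 2 :* (con 1 :+ K) :+ D)) refl k d))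

[n+1]*nCk≤n*nC[k+1] : ∀ {n k} → 2 * suc k ≤ n → (n + 1) * (n C k) ≤ n * (n C suc k)
[n+1]*nCk≤n*nC[k+1] {n} {k} 2[k+1]≤n = *-cancelˡ-≤ (suc k) (+-cancelʳ-≤ (n * k * a) _ _ (begin
  suc k * ((n + 1) * a) + n * k * a
    ≡⟨ solve 3 (λ N K A → (con 1 :+ K) :* ((N :+ con 1) :* A) :+ N :* K :* A
                        := ((con 1 :+ K) :* (N :+ con 1) :+ N :* K) :* A) refl n k a ⟩
  (suc k * (n + 1) + n * k) * a
    ≤⟨ *-monoˡ-≤ a ([k+1]*[n+1]+n*k≤n*n 2[k+1]≤n) ⟩
  n * n * a
    ≡⟨ *-assoc n n a ⟩
  n * (n * a)
    ≡⟨ cong (n *_) ([k+1]*nC[k+1]+k*nCk≡n*nCk n k) ⟨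
  n * (suc k * b + k * a)
    ≡⟨ solve 4 (λ N K A B → N :* ((con 1 :+ K) :* B :+ K :* A) := (con 1 :+ K) :* (N :* B) :+ N :* K :* A)
             refl n k a b ⟩
  suc k * (n * b) + n * k * a
    ∎))
  where
  open ≤-Reasoning
  a = n C k
  b = n C suc k

theorem2p5 : (n k : ℕ) → 6 ≤ n → 1 ≤ k → 2 * k ≤ n
    → 2 ^ n < (n + 1) * (n C k)
    → n * (n C k) ≤ 2 ^ n
    → IsLeastF n k
theorem2p5 n (suc k) _ 1≤k 2k≤n big small = 1≤k , big , smaller-not-big
  where
  smaller-not-big : ∀ s → 1 ≤ s → s < suc k → BigBinom n s → ⊥
  smaller-not-big s _ (s≤s s≤k) s-big = <⇒≱ s-big (begin
    (n + 1) * (n C s)      ≤⟨ *-monoʳ-≤ (n + 1) (nCi≤nCj (≤⇒≤′ s≤k) (<⇒≤ (<-≤-trans (2*k<2*[1+k] k) 2k≤n))) ⟩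
    (n + 1) * (n C k)      ≤⟨ [n+1]*nCk≤n*nC[k+1] 2k≤n ⟩
    n * (n C suc k)        ≤⟨ small ⟩
    2 ^ n                  ∎)
    where open ≤-Reasoning
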